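{- Let $(K,\le,\wedge,\vee,0,1,{}^\circ)$ be a quasiintuitionistic algebra and let $K_{\circ\circ}:=\{x^{\circ\circ}\mid x\in K\}\subseteq K$, equipped with the restriction of $\le$ and of ${}^\circ$. Then $(K_{\circ\circ},\le,\wedge,\curlyvee,0,1,{}^\circ)$ is an orthocomplemented lattice, where: (i) the join is $\alpha\curlyvee\beta:=(\alpha\vee\beta)^{\circ\circ}$ for $\alpha,\beta\in K_{\circ\circ}$; (ii) the meet is the meet $\wedge$ of $K$ restricted to $K_{\circ\circ}$; (iii) the bottom and top elements are $0$ and $1$; (iv) the orthocomplementation is ${}^\circ$.
   Context: A quasiintuitionistic algebra is a bounded distributive lattice $(K,\le,\wedge,\vee,0,1)$ with a map ${}^\circ:K\to K$ such that for all $x,y\in K$: $x\le y$ implies $y^\circ\le x^\circ$; $x\le x^{\circ\circ}$; $x\wedge x^\circ\le y$. An orthocomplemented lattice is a bounded lattice with a map ${}^\perp$ such that $x\le y$ implies $y^\perp\le x^\perp$, $x^{\perp\perp}=x$, $x\wedge x^\perp=0$, $x\vee x^\perp=1$. -}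

module Defs where

open import Level using (Level; suc; _⊔_)
open import Algebra.Core using (Op₁; Op₂)
open import Algebra.Definitions using (_DistributesOverˡ_)
open import Data.Product using (Σ; ∃; _,_; proj₁)
open import Relation.Binary.Core using (Rel)
open import Relation.Binary.Lattice.Structures using (IsBoundedLattice)

record IsQuasiIntuitionisticAlgebra {a ℓ₁ ℓ₂} {A : Set a}
         (_≈_ : Rel A ℓ₁) (_≤_ : Rel A ℓ₂)
         (_∨_ : Op₂ A) (_∧_ : Op₂ A) (⊤ : A) (⊥ : A) (_° : Op₁ A)
         : Set (a ⊔ ℓ₁ ⊔ ℓ₂) where
  field
    isBoundedLattice : IsBoundedLattice _≈_ _≤_ _∨_ _∧_ ⊤ ⊥
    ∧-distribˡ-∨     : _DistributesOverˡ_ _≈_ _∧_ _∨_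
    °-antitone       : ∀ {x y} → x ≤ y → (y °) ≤ (x °)
    °°-inflationary  : ∀ x → x ≤ ((x °) °)
    °-explosion      : ∀ x y → (x ∧ (x °)) ≤ y

record IsOrthocomplementedLattice {a ℓ₁ ℓ₂} {A : Set a}
         (_≈_ : Rel A ℓ₁) (_≤_ : Rel A ℓ₂)
         (_∨_ : Op₂ A) (_∧_ : Op₂ A) (⊤ : A) (⊥ : A) (_ᶜ : Op₁ A)
         : Set (a ⊔ ℓ₁ ⊔ ℓ₂) where
  field
    isBoundedLattice : IsBoundedLattice _≈_ _≤_ _∨_ _∧_ ⊤ ⊥
    ᶜ-antitone       : ∀ {x y} → x ≤ y → (y ᶜ) ≤ (x ᶜ)
    ᶜ-involutive     : ∀ x → ((x ᶜ) ᶜ) ≈ x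
    ∧-ᶜ              : ∀ x → (x ∧ (x ᶜ)) ≈ ⊥
    ∨-ᶜ              : ∀ x → (x ∨ (x ᶜ)) ≈ ⊤

record QuasiIntuitionisticAlgebra c ℓ₁ ℓ₂ : Set (suc (c ⊔ ℓ₁ ⊔ ℓ₂)) where
  infix  4 _≈_ _≤_
  infixr 6 _∨_
  infixr 7 _∧_
  field
    Carrier : Set c
    _≈_     : Rel Carrier ℓ₁
    _≤_     : Rel Carrier ℓ₂
    _∨_     : Op₂ Carrier
    _∧_     : Op₂ Carrier
    ⊤       : Carrier
    ⊥       : Carrier
    _°      : Op₁ Carrier
    isQuasiIntuitionisticAlgebra :
      IsQuasiIntuitionisticAlgebra _≈_ _≤_ _∨_ _∧_ ⊤ ⊥ _°

  open IsQuasiIntuitionisticAlgebra isQuasiIntuitionisticAlgebra public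

module DoubleNeg {c ℓ₁ ℓ₂} (K : QuasiIntuitionisticAlgebra c ℓ₁ ℓ₂) where
  open QuasiIntuitionisticAlgebra K

  K°° : Set (c ⊔ ℓ₁)
  K°° = Σ Carrier (λ a → ∃ (λ x → a ≈ ((x °) °)))

  ι : K°° → Carrier
  ι = proj₁

  _≈°°_ : Rel K°° ℓ₁
  α ≈°° β = ι α ≈ ι β

  _≤°°_ : Rel K°° ℓ₂
  α ≤°° β = ι α ≤ ι β

-- Since x° = x°°°, the map x ↦ x°° is a closure operator whose fixed points ("regular"
-- elements) are exactly K°°.  Regular elements are closed under ∧, °, ⊤ and ⊥, and the
-- least regular element above x ∨ y is (x ∨ y)°°, so K°° is a bounded lattice.  The
-- orthocomplement laws: x ∧ x° = ⊥ is the explosion axiom, and (x ∨ x°)°° = ⊤ because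
-- (x ∨ x°)° ≤ x° ∧ x°° = ⊥ and ⊥° = ⊤.
module Submission where

open import Defs
open import Algebra.Core using (Op₁; Op₂)
open import Data.Product using (Σ; _×_; _,_)
open import Relation.Binary.Lattice.Structures using (IsBoundedLattice)
import Relation.Binary.Construct.On as On

module QuasiIntuitionisticAlgebraProperties
  {c ℓ₁ ℓ₂} (K : QuasiIntuitionisticAlgebra c ℓ₁ ℓ₂) where

  open QuasiIntuitionisticAlgebra K
  open IsBoundedLattice isBoundedLattice public

  °-cong : ∀ {x y} → x ≈ y → x ° ≈ y °
  °-cong x≈y = antisym (°-antitone (reflexive (Eq.sym x≈y))) (°-antitone (reflexive x≈y))

  °°-monotone : ∀ {x y} → x ≤ y → (x °) ° ≤ (y °) °
  °°-monotone x≤y = °-antitone (°-antitone x≤y)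

  °°°≈° : ∀ x → ((x °) °) ° ≈ x °
  °°°≈° x = antisym (°-antitone (°°-inflationary x)) (°°-inflationary (x °))

  ⊤°≤⊥ : ⊤ ° ≤ ⊥
  ⊤°≤⊥ = trans (∧-greatest (maximum (⊤ °)) refl) (°-explosion ⊤ ⊥)

  ⊤≤⊥° : ⊤ ≤ ⊥ °
  ⊤≤⊥° = trans (°°-inflationary ⊤) (°-antitone (minimum (⊤ °)))

  °-∨-≤ : ∀ x y → (x ∨ y) ° ≤ x ° ∧ y °
  °-∨-≤ x y = ∧-greatest (°-antitone (x≤x∨y x y)) (°-antitone (y≤x∨y x y))

  °°-excluded-middle : ∀ x → ⊤ ≤ ((x ∨ x °) °) °
  °°-excluded-middle x =
    trans ⊤≤⊥° (°-antitone (trans (°-∨-≤ x (x °)) (°-explosion (x °) ⊥)))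

  Regular : Carrier → Set ℓ₁
  Regular x = (x °) ° ≈ x

  °°≤⇒regular : ∀ {x} → (x °) ° ≤ x → Regular x
  °°≤⇒regular x°°≤x = antisym x°°≤x (°°-inflationary _)

  ⊤-regular : Regular ⊤
  ⊤-regular = °°≤⇒regular (maximum _)

  ⊥-regular : Regular ⊥
  ⊥-regular = °°≤⇒regular (trans (°-antitone ⊤≤⊥°) ⊤°≤⊥)

  ∧-regular : ∀ {x y} → Regular x → Regular y → Regular (x ∧ y)
  ∧-regular {x} {y} x-reg y-reg = °°≤⇒regular (∧-greatest
    (trans (°°-monotone (x∧y≤x x y)) (reflexive x-reg))
    (trans (°°-monotone (x∧y≤y x y)) (reflexive y-reg)))

  °°-least : ∀ {x z} → Regular z → x ≤ z → (x °) ° ≤ z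
  °°-least z-reg x≤z = trans (°°-monotone x≤z) (reflexive z-reg)

module DoubleNegationLattice {c ℓ₁ ℓ₂} (K : QuasiIntuitionisticAlgebra c ℓ₁ ℓ₂) where

  open QuasiIntuitionisticAlgebra K
    using (Carrier; _∨_; _°; ⊥; °-antitone; °°-inflationary; °-explosion)
  open QuasiIntuitionisticAlgebraProperties K
  open DoubleNeg K

  ι-regular : (α : K°°) → Regular (ι α)
  ι-regular (a , x , a≈x°°) =
    Eq.trans (°-cong (°-cong a≈x°°)) (Eq.trans (°-cong (°°°≈° x)) (Eq.sym a≈x°°))

  fromRegular : ∀ {x} → Regular x → K°°
  fromRegular {x} x-reg = x , x , Eq.sym x-reg

  closure : Carrier → K°°
  closure x = (x °) ° , x , Eq.refl

  _⋏_ : Op₂ K°°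
  α ⋏ β = fromRegular (∧-regular (ι-regular α) (ι-regular β))

  _⋎_ : Op₂ K°°
  α ⋎ β = closure (ι α ∨ ι β)

  top : K°°
  top = fromRegular ⊤-regular

  bot : K°°
  bot = fromRegular ⊥-regular

  compl : Op₁ K°°
  compl α = fromRegular (°°°≈° (ι α))

  isBoundedLattice°° : IsBoundedLattice _≈°°_ _≤°°_ _⋎_ _⋏_ top bot
  isBoundedLattice°° = record
    { isLattice = record
      { isPartialOrder = On.isPartialOrder ι isPartialOrder
      ; supremum       = λ α β →
            trans (x≤x∨y _ _) (°°-inflationary _)
          , trans (y≤x∨y _ _) (°°-inflationary _)
          , λ γ α≤γ β≤γ → °°-least (ι-regular γ) (∨-least α≤γ β≤γ)
      ; infimum        = λ α β → x∧y≤x _ _ , x∧y≤y _ _ , λ γ → ∧-greatest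
      }
    ; maximum = λ α → maximum (ι α)
    ; minimum = λ α → minimum (ι α)
    }

  isOrthocomplementedLattice°° :
    IsOrthocomplementedLattice _≈°°_ _≤°°_ _⋎_ _⋏_ top bot compl
  isOrthocomplementedLattice°° = record
    { isBoundedLattice = isBoundedLattice°°
    ; ᶜ-antitone       = °-antitone
    ; ᶜ-involutive     = ι-regular
    ; ∧-ᶜ              = λ α → antisym (°-explosion (ι α) ⊥) (minimum _)
    ; ∨-ᶜ              = λ α → antisym (maximum _) (°°-excluded-middle (ι α))
    }

mainTheorem4 : ∀ {c ℓ₁ ℓ₂} (K : QuasiIntuitionisticAlgebra c ℓ₁ ℓ₂) →
  let open QuasiIntuitionisticAlgebra K
      open DoubleNeg K
  in Σ (Op₂ K°°) λ _⋏_ → Σ (Op₂ K°°) λ _⋎_ → Σ K°° λ top → Σ K°° λ bot →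
     Σ (Op₁ K°°) λ comp →
       (∀ α β → ι (α ⋏ β) ≈ (ι α ∧ ι β))
     × (∀ α β → ι (α ⋎ β) ≈ (((ι α ∨ ι β) °) °))
     × (ι top ≈ ⊤)
     × (ι bot ≈ ⊥)
     × (∀ α → ι (comp α) ≈ (ι α °))
     × IsOrthocomplementedLattice _≈°°_ _≤°°_ _⋎_ _⋏_ top bot comp
mainTheorem4 K =
  _⋏_ , _⋎_ , top , bot , compl ,
  (λ _ _ → Eq.refl) , (λ _ _ → Eq.refl) , Eq.refl , Eq.refl , (λ _ → Eq.refl) ,
  isOrthocomplementedLattice°°
  where
  open DoubleNegationLattice K
  open QuasiIntuitionisticAlgebraProperties K using (module Eq)
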